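{- Let $G=(V,E\cup A)$ be a mixed graph. Every mixed covering forest in $G$ is a mixed edge cover. Moreover, a subset $F\subseteq E\cup A$ is an inclusionwise minimal mixed edge cover if and only if it is an inclusionwise minimal mixed covering forest.
   Context: A mixed graph $G=(V,E\cup A)$ has a finite vertex set $V$, undirected edges $E$ and directed arcs $A$; no loops, parallel edges/arcs allowed. Each arc has one head; both endpoints of an edge are regarded as its heads; $v$ is covered by $e$ if $v$ is a head of $e$. A mixed edge cover is a subset $F\subseteq E\cup A$ such that for every $v\in V$ there is a directed path (possibly of length $0$) using only arcs of $F\cap A$ from an endpoint of some edge of $F\cap E$ to $v$. A mixed covering forest is a subset $F\subseteq E\cup A$ such that (i) the underlying undirected graph of $F$ has no cycle and (ii) every vertex of $V$ is covered at least once in $F$. -}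

module Defs where

open import Data.Nat as ℕ using (ℕ; zero; suc)
open import Data.Fin using (Fin; zero; suc; toℕ; fromℕ<)
open import Data.Fin.Subset using (Subset; _∈_; _⊆_)
open import Data.Sum using (_⊎_; inj₁; inj₂)
open import Data.Product using (Σ; ∃; ∃-syntax; _×_; _,_)
open import Relation.Binary.PropositionalEquality using (_≡_; _≢_)
open import Relation.Nullary using (¬_; yes; no)
open import Function.Definitions using (Injective)

-- A mixed graph on vertex set Fin n.  Edges are indexed by Fin m, arcs by
-- Fin k; parallel edges/arcs are allowed (indexing), loops are not.
record MixedGraph (n : ℕ) : Set where
  field
    m    : ℕ
    k    : ℕ
    end₁ : Fin m → Fin n
    end₂ : Fin m → Fin n
    noLoopE : ∀ e → end₁ e ≢ end₂ e
    tail : Fin k → Fin n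
    head : Fin k → Fin n
    noLoopA : ∀ a → tail a ≢ head a

module _ {n : ℕ} (G : MixedGraph n) where
  open MixedGraph G

  Sub : Set
  Sub = Subset m × Subset k

  _⊑_ : Sub → Sub → Set
  (FE , FA) ⊑ (FE' , FA') = (FE ⊆ FE') × (FA ⊆ FA')

  data Reach (FA : Subset k) (u : Fin n) : Fin n → Set where
    here : Reach FA u u
    step : ∀ {w} (a : Fin k) → Reach FA u w → a ∈ FA → tail a ≡ w →
           Reach FA u (head a)

  IsMixedEdgeCover : Sub → Set
  IsMixedEdgeCover (FE , FA) =
    ∀ (v : Fin n) → ∃[ e ] (e ∈ FE × ((Reach FA (end₁ e) v) ⊎ (Reach FA (end₂ e) v)))

  Elem : Set
  Elem = Fin m ⊎ Fin k

  _∈F_ : Elem → Sub → Set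
  inj₁ e ∈F (FE , FA) = e ∈ FE
  inj₂ a ∈F (FE , FA) = a ∈ FA

  fst snd : Elem → Fin n
  fst (inj₁ e) = end₁ e
  fst (inj₂ a) = tail a
  snd (inj₁ e) = end₂ e
  snd (inj₂ a) = head a

  Joins : Elem → Fin n → Fin n → Set
  Joins x u v = (fst x ≡ u × snd x ≡ v) ⊎ (fst x ≡ v × snd x ≡ u)

  next : ∀ {l} → Fin (suc l) → Fin (suc l)
  next {l} i with toℕ i ℕ.<? l
  ... | yes p = suc (fromℕ< p)
  ... | no _  = zero

  -- a cycle in the underlying undirected (multi)graph of F:
  -- distinct elements x₀,…,x_{r-1} and distinct vertices v₀,…,v_{r-1}
  -- (r ≥ 2) with x_i joining v_i and v_{i+1 mod r}, all x_i in F.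
  record Cycle (F : Sub) : Set where
    field
      len   : ℕ
      elems : Fin (suc (suc len)) → Elem
      verts : Fin (suc (suc len)) → Fin n
      elems-inj : Injective _≡_ _≡_ elems
      verts-inj : Injective _≡_ _≡_ verts
      inF   : ∀ i → elems i ∈F F
      joins : ∀ i → Joins (elems i) (verts i) (verts (next i))

  -- v is covered by F: v is a head of some element of F
  Covered : Sub → Fin n → Set
  Covered (FE , FA) v =
    (∃[ e ] (e ∈ FE × (end₁ e ≡ v ⊎ end₂ e ≡ v))) ⊎ (∃[ a ] (a ∈ FA × head a ≡ v))

  IsMixedCoveringForest : Sub → Set
  IsMixedCoveringForest F = ¬ Cycle F × (∀ v → Covered F v)

  Minimal : (Sub → Set) → Sub → Set
  Minimal P F = P F × (∀ F' → F' ⊑ F → P F' → F' ≡ F)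

module Submission where

-- Walking backwards from a vertex along covering arcs of a covering forest never
-- revisits a vertex (that would close a directed cycle), so the walk ends at an endpoint
-- of an edge: covering forests are edge covers.  In a minimal edge cover, an arc is the
-- only way to reach its head and an edge cannot have both endpoints reached without it;
-- hence no arc head is an edge endpoint and no two arcs share a head.  Along a cycle
-- these constraints propagate: either all elements are edges (and the middle one of three
-- consecutive edges is redundant), or all are arcs forming a directed cycle, which a path
-- from an edge must enter through an arc whose predecessor it avoids.  So minimal edge
-- covers are forests, and each notion of minimality implies the other.

open import Defs
open import Data.Bool using (Bool; true; false; T)
open import Data.Empty using (⊥; ⊥-elim)
open import Data.Fin using (Fin; zero; suc; toℕ; fromℕ; inject₁; inject≤; _≟_)
open import Data.Fin.Induction using (<-weakInduction; <-weakInduction-startingFrom)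
open import Data.Fin.Properties
  using (toℕ-injective; toℕ-inject₁; toℕ-inject≤; inject≤-injective; toℕ-fromℕ; toℕ-fromℕ<; toℕ<n;
         ≤fromℕ; injective⇒≤; any?)
open import Data.Fin.Subset using (Subset; _∈_; _-_)
open import Data.Fin.Subset.Properties using (x∈p∧x≢y⇒x∈p-y; p─q⊆p; x∈p⇒p-x⊂p)
open import Data.Nat as ℕ using (ℕ; zero; suc; _+_; _<_)
import Data.Nat.Properties as ℕ
open import Data.Product using (∃-syntax; _×_; _,_; proj₁; proj₂)
open import Data.Sum using (_⊎_; inj₁; inj₂; [_,_]′)
open import Data.Sum.Properties using (inj₂-injective)
open import Data.Unit using (tt)
open import Data.Vec.Functional using (_∷_)
open import Function.Base using (id; _∘_)
open import Function.Bundles using (_⇔_; mk⇔)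
open import Function.Definitions using (Injective)
open import Relation.Binary.PropositionalEquality
open import Relation.Nullary using (¬_; Dec; yes; no; contradiction)
open import Relation.Nullary.Decidable using (T?; _⊎-dec_)

p-x≢p : ∀ {l} {p : Subset l} {x} → x ∈ p → p - x ≢ p
p-x≢p x∈p p-x≡p with x∈p⇒p-x⊂p x∈p
... | _ , y , y∈p , y∉p-x = y∉p-x (subst (_ ∈_) (sym p-x≡p) y∈p)

data InitLast : ∀ {l} → Fin (suc l) → Set where
  last : ∀ {l} → InitLast (fromℕ l)
  init : ∀ {l} (j : Fin l) → InitLast (inject₁ j)

initLast : ∀ {l} (i : Fin (suc l)) → InitLast i
initLast {zero} zero = last
initLast {suc l} zero = init zero
initLast {suc l} (suc i) with initLast i
... | last = last
... | init j = init (suc j)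

module _ {n : ℕ} (G : MixedGraph n) where
  open MixedGraph G

  -- `next` ignores its graph argument; it only takes one because it is declared per graph.
  next-inject₁ : ∀ {l} (j : Fin l) → next G (inject₁ j) ≡ suc j
  next-inject₁ {l} j with toℕ (inject₁ j) ℕ.<? l
  ... | yes p = cong suc (toℕ-injective (trans (toℕ-fromℕ< p) (toℕ-inject₁ j)))
  ... | no ¬p = contradiction (subst (_< l) (sym (toℕ-inject₁ j)) (toℕ<n j)) ¬p

  next-fromℕ : ∀ {l} → next G (fromℕ l) ≡ zero
  next-fromℕ {l} with toℕ (fromℕ l) ℕ.<? l
  ... | yes p = contradiction (subst (_< l) (toℕ-fromℕ l) p) (ℕ.<-irrefl refl)
  ... | no _ = refl

  next-induction : ∀ {l} (P : Fin (suc l) → Set) → (∀ i → P i → P (next G i)) →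
                   ∀ {j} → P j → ∀ i → P i
  next-induction P advance {j} Pj = <-weakInduction P P₀ up
    where
      up : ∀ i → P (inject₁ i) → P (suc i)
      up i = subst P (next-inject₁ i) ∘ advance (inject₁ i)
      P₀ : P zero
      P₀ = subst P next-fromℕ (advance _ (<-weakInduction-startingFrom P Pj up (≤fromℕ j)))

  next-surjective : ∀ {l} (i : Fin (suc l)) → ∃[ p ] next G p ≡ i
  next-surjective = next-induction (λ i → ∃[ p ] next G p ≡ i)
    (λ { _ (p , refl) → next G p , refl }) {next G zero} (zero , refl)

  next-≢ : ∀ {l} (i : Fin (suc (suc l))) → next G i ≢ i
  next-≢ {l} i with initLast i
  ... | last rewrite next-fromℕ {suc l} = λ ()
  ... | init j rewrite next-inject₁ j = ℕ.1+n≢n ∘ λ eq → trans (cong toℕ eq) (toℕ-inject₁ j)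

  Reach-trans : ∀ {FA u w v} → Reach G FA u w → Reach G FA w v → Reach G FA u v
  Reach-trans p here = p
  Reach-trans p (step a q a∈ t) = step a (Reach-trans p q) a∈ t

  arc-Reach : ∀ {FA a} → a ∈ FA → Reach G FA (tail a) (head a)
  arc-Reach {a = a} a∈ = step a here a∈ refl

  Reach-after-last : ∀ {FA s v} a → Reach G FA s v →
                     Reach G (FA - a) s v ⊎ Reach G (FA - a) (head a) v
  Reach-after-last a here = inj₁ here
  Reach-after-last a (step b p b∈ t) with b ≟ a
  ... | yes refl = inj₂ here
  ... | no b≢a with Reach-after-last a p
  ...   | inj₁ q = inj₁ (step b q (x∈p∧x≢y⇒x∈p-y b∈ b≢a) t)
  ...   | inj₂ q = inj₂ (step b q (x∈p∧x≢y⇒x∈p-y b∈ b≢a) t)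

  Reach-before-first : ∀ {FA s v} {S : Fin k → Set} → (∀ c → Dec (S c)) → Reach G FA s v →
                       (∀ {d} → S d → Reach G (FA - d) s v) ⊎
                       ∃[ c ] (S c × (∀ {d} → S d → Reach G (FA - d) s (tail c)))
  Reach-before-first S? here = inj₁ (λ _ → here)
  Reach-before-first S? (step b p b∈ t) with Reach-before-first S? p
  ... | inj₂ entry = inj₂ entry
  ... | inj₁ avoid with S? b
  ...   | yes Sb = inj₂ (b , Sb , λ Sd → subst (Reach G _ _) (sym t) (avoid Sd))
  ...   | no ¬Sb = inj₁ λ Sd → step b (avoid Sd) (x∈p∧x≢y⇒x∈p-y b∈ λ { refl → ¬Sb Sd }) t

  EndOf : Fin m → Fin n → Set
  EndOf e v = end₁ e ≡ v ⊎ end₂ e ≡ v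

  Joins-left : ∀ {e u v} → Joins G (inj₁ e) u v → EndOf e u
  Joins-left (inj₁ (p , _)) = inj₁ p
  Joins-left (inj₂ (_ , q)) = inj₂ q

  Joins-right : ∀ {e u v} → Joins G (inj₁ e) u v → EndOf e v
  Joins-right (inj₁ (_ , q)) = inj₂ q
  Joins-right (inj₂ (p , _)) = inj₁ p

  Source : Subset m → Fin n → Set
  Source FE s = ∃[ e ] (e ∈ FE × EndOf e s)

  ReachedFrom : Subset m → Subset k → Fin n → Set
  ReachedFrom FE FA v = ∃[ s ] (Source FE s × Reach G FA s v)

  ReachedFrom-extend : ∀ {FE FA u v} → ReachedFrom FE FA u → Reach G FA u v → ReachedFrom FE FA v
  ReachedFrom-extend (s , src , p) q = s , src , Reach-trans p q

  ReachedFrom-before-first : ∀ {FE FA v} {S : Fin k → Set} → (∀ c → Dec (S c)) → ReachedFrom FE FA v →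
                             (∀ {d} → S d → ReachedFrom FE (FA - d) v) ⊎
                             ∃[ c ] (S c × (∀ {d} → S d → ReachedFrom FE (FA - d) (tail c)))
  ReachedFrom-before-first S? (s , src , p) with Reach-before-first S? p
  ... | inj₁ avoid = inj₁ λ Sd → s , src , avoid Sd
  ... | inj₂ (c , Sc , avoid) = inj₂ (c , Sc , λ Sd → s , src , avoid Sd)

  edge-cover⇒reached : ∀ {FE FA} → IsMixedEdgeCover G (FE , FA) → ∀ v → ReachedFrom FE FA v
  edge-cover⇒reached cover v with cover v
  ... | e , e∈ , inj₁ p = _ , (e , e∈ , inj₁ refl) , p
  ... | e , e∈ , inj₂ p = _ , (e , e∈ , inj₂ refl) , p

  reached⇒edge-cover : ∀ {FE FA} → (∀ v → ReachedFrom FE FA v) → IsMixedEdgeCover G (FE , FA)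
  reached⇒edge-cover reached v with reached v
  ... | _ , (e , e∈ , inj₁ refl) , p = e , e∈ , inj₁ p
  ... | _ , (e , e∈ , inj₂ refl) , p = e , e∈ , inj₂ p

  reached⇒covered : ∀ {FE FA v} → ReachedFrom FE FA v → Covered G (FE , FA) v
  reached⇒covered (_ , src , here) = inj₁ src
  reached⇒covered (_ , _ , step a _ a∈ _) = inj₂ (a , a∈ , refl)

  edge-cover⇒covers : ∀ {FE FA} → IsMixedEdgeCover G (FE , FA) → ∀ v → Covered G (FE , FA) v
  edge-cover⇒covers cover = reached⇒covered ∘ edge-cover⇒reached cover

  ∈F-mono : ∀ {FE FA FE' FA'} → _⊑_ G (FE' , FA') (FE , FA) →
            ∀ x → _∈F_ G x (FE' , FA') → _∈F_ G x (FE , FA)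
  ∈F-mono (FE'⊆FE , _) (inj₁ e) = FE'⊆FE
  ∈F-mono (_ , FA'⊆FA) (inj₂ a) = FA'⊆FA

  Cycle-mono : ∀ {FE FA FE' FA'} → _⊑_ G (FE' , FA') (FE , FA) → Cycle G (FE' , FA') → Cycle G (FE , FA)
  Cycle-mono F'⊑F C = record
    { len = len ; elems = elems ; verts = verts ; elems-inj = elems-inj ; verts-inj = verts-inj
    ; inF = λ i → ∈F-mono F'⊑F (elems i) (inF i) ; joins = joins }
    where open Cycle C

  record SimplePath (FA : Subset k) (t : ℕ) : Set where
    field
      vertex : Fin (suc t) → Fin n
      vertex-injective : Injective _≡_ _≡_ vertex
      arc : Fin t → Fin k
      arc∈ : ∀ j → arc j ∈ FA
      tail-arc : ∀ j → tail (arc j) ≡ vertex (inject₁ j)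
      head-arc : ∀ j → head (arc j) ≡ vertex (suc j)

  open SimplePath

  module _ {FA : Subset k} where
    single : Fin n → SimplePath FA 0
    single v = record
      { vertex = λ _ → v ; vertex-injective = λ { {zero} {zero} _ → refl }
      ; arc = λ () ; arc∈ = λ () ; tail-arc = λ () ; head-arc = λ () }

    prepend : ∀ {t} (P : SimplePath FA t) {c} → c ∈ FA → head c ≡ vertex P zero →
              (∀ j → vertex P j ≢ tail c) → SimplePath FA (suc t)
    prepend P {c} c∈ head-c fresh = record
      { vertex = tail c ∷ vertex P ; vertex-injective = injective
      ; arc = c ∷ arc P ; arc∈ = arc∈′ ; tail-arc = tail-arc′ ; head-arc = head-arc′ }
      where
        injective : Injective _≡_ _≡_ (tail c ∷ vertex P)
        injective {zero} {zero} _ = refl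
        injective {zero} {suc y} eq = contradiction (sym eq) (fresh y)
        injective {suc x} {zero} eq = contradiction eq (fresh x)
        injective {suc x} {suc y} eq = cong suc (vertex-injective P eq)
        arc∈′ : ∀ j → (c ∷ arc P) j ∈ FA
        arc∈′ zero = c∈
        arc∈′ (suc j) = arc∈ P j
        tail-arc′ : ∀ j → tail ((c ∷ arc P) j) ≡ (tail c ∷ vertex P) (inject₁ j)
        tail-arc′ zero = refl
        tail-arc′ (suc j) = tail-arc P j
        head-arc′ : ∀ j → head ((c ∷ arc P) j) ≡ (tail c ∷ vertex P) (suc j)
        head-arc′ zero = head-c
        head-arc′ (suc j) = head-arc P j

    truncate : ∀ {t} → SimplePath FA t → (j : Fin (suc t)) → SimplePath FA (toℕ j)
    truncate P j = record
      { vertex = vertex P ∘ embed ; vertex-injective = inject≤-injective _ _ _ _ ∘ vertex-injective P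
      ; arc = arc P ∘ embed-arc ; arc∈ = arc∈ P ∘ embed-arc
      ; tail-arc = λ i → trans (tail-arc P _) (cong (vertex P) (toℕ-injective (toℕ-commute i)))
      ; head-arc = head-arc P ∘ embed-arc }
      where
        embed : Fin (suc (toℕ j)) → Fin (suc _)
        embed i = inject≤ i (toℕ<n j)
        embed-arc : Fin (toℕ j) → Fin _
        embed-arc i = inject≤ i (ℕ.s≤s⁻¹ (toℕ<n j))
        toℕ-commute : ∀ i → toℕ (inject₁ (embed-arc i)) ≡ toℕ (embed (inject₁ i))
        toℕ-commute i = begin
          toℕ (inject₁ (embed-arc i))  ≡⟨ toℕ-inject₁ _ ⟩
          toℕ (embed-arc i)            ≡⟨ toℕ-inject≤ i _ ⟩
          toℕ i                        ≡⟨ toℕ-inject₁ i ⟨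
          toℕ (inject₁ i)              ≡⟨ toℕ-inject≤ (inject₁ i) _ ⟨
          toℕ (embed (inject₁ i))      ∎
          where open ≡-Reasoning

    truncate-last : ∀ {t} (P : SimplePath FA t) j → vertex (truncate P j) (fromℕ (toℕ j)) ≡ vertex P j
    truncate-last P j = cong (vertex P) (toℕ-injective (trans (toℕ-inject≤ _ _) (toℕ-fromℕ _)))

    close : ∀ {FE l} (P : SimplePath FA (suc l)) {c} → c ∈ FA →
            tail c ≡ vertex P (fromℕ (suc l)) → head c ≡ vertex P zero → Cycle G (FE , FA)
    close {l = l} P {c} c∈ tail-c head-c = record
      { len = l ; elems = inj₂ ∘ cyclic-arc ; verts = vertex P
      ; elems-inj = λ {x} {y} eq → vertex-injective P
          (trans (sym (cyclic-tail x)) (trans (cong tail (inj₂-injective eq)) (cyclic-tail y)))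
      ; verts-inj = vertex-injective P ; inF = cyclic-arc∈
      ; joins = λ i → inj₁ (cyclic-tail i , cyclic-head i) }
      where
        cyclic-arc : Fin (suc (suc l)) → Fin k
        cyclic-arc i with initLast i
        ... | last = c
        ... | init j = arc P j
        cyclic-arc∈ : ∀ i → cyclic-arc i ∈ FA
        cyclic-arc∈ i with initLast i
        ... | last = c∈
        ... | init j = arc∈ P j
        cyclic-tail : ∀ i → tail (cyclic-arc i) ≡ vertex P i
        cyclic-tail i with initLast i
        ... | last = tail-c
        ... | init j = tail-arc P j
        cyclic-head : ∀ i → head (cyclic-arc i) ≡ vertex P (next G i)
        cyclic-head i with initLast i
        ... | last = trans head-c (cong (vertex P) (sym next-fromℕ))
        ... | init j = trans (head-arc P j) (cong (vertex P) (sym (next-inject₁ j)))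

  module _ {FE : Subset m} {FA : Subset k} (acyclic : ¬ Cycle G (FE , FA))
           (covered : ∀ v → Covered G (FE , FA) v) (v : Fin n) where

    -- Follow covering arcs backwards from v; a repeated vertex closes a cycle, and the
    -- fuel f bounds the number of fresh vertices still available.
    grow : ∀ f {t} → t + f ≡ n → (P : SimplePath FA t) → Reach G FA (vertex P zero) v →
           ReachedFrom FE FA v
    grow zero {t} t+0≡n P _ =
      ⊥-elim (ℕ.<-irrefl (sym (ℕ.+-identityʳ t))
                          (subst (t <_) (sym t+0≡n) (injective⇒≤ (vertex-injective P))))
    grow (suc f) {t} t+f≡n P reach with covered (vertex P zero)
    ... | inj₁ src = _ , src , reach
    ... | inj₂ (c , c∈ , head-c) with any? (λ j → vertex P j ≟ tail c)
    ...   | yes (zero , tail-c) = contradiction (trans (sym tail-c) (sym head-c)) (noLoopA c)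
    ...   | yes (suc j , tail-c) =
      ⊥-elim (acyclic (close (truncate P (suc j)) c∈ (trans (sym tail-c) (sym (truncate-last P (suc j)))) head-c))
    ...   | no fresh = grow f (trans (sym (ℕ.+-suc t f)) t+f≡n)
      (prepend P c∈ head-c λ j eq → fresh (j , eq))
      (Reach-trans (arc-Reach c∈) (subst (λ w → Reach G FA w v) (sym head-c) reach))

    reached-from-edges : ReachedFrom FE FA v
    reached-from-edges = grow n refl (single v) here

  covering-forest⇒edge-cover : ∀ F → IsMixedCoveringForest G F → IsMixedEdgeCover G F
  covering-forest⇒edge-cover (FE , FA) (acyclic , covered) =
    reached⇒edge-cover (reached-from-edges acyclic covered)

  record Along (x : Elem G) (u v : Fin n) : Set where
    field
      {arc} : Fin k
      is-arc : x ≡ inj₂ arc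
      tail≡ : tail arc ≡ u
      head≡ : head arc ≡ v

  data Traversal (x : Elem G) (u v : Fin n) : Set where
    edge : ∀ {e} → x ≡ inj₁ e → Joins G (inj₁ e) u v → Traversal x u v
    forward : Along x u v → Traversal x u v
    backward : Along x v u → Traversal x u v

  traversal : ∀ {x u v} → Joins G x u v → Traversal x u v
  traversal {inj₁ e} joins = edge refl joins
  traversal {inj₂ a} (inj₁ (t , h)) = forward (record { is-arc = refl ; tail≡ = t ; head≡ = h })
  traversal {inj₂ a} (inj₂ (t , h)) = backward (record { is-arc = refl ; tail≡ = t ; head≡ = h })

  isForward isEdge : ∀ {x u v} → Traversal x u v → Bool
  isForward (forward _) = true
  isForward _ = false
  isEdge (edge _ _) = true
  isEdge _ = false

  forward-arc : ∀ {x u v} (t : Traversal x u v) → T (isForward t) → Along x u v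
  forward-arc (forward along) _ = along

  backward-arc : ∀ {x u v} (t : Traversal x u v) → ¬ T (isForward t) → ¬ T (isEdge t) → Along x v u
  backward-arc (edge _ _) _ not-edge = ⊥-elim (not-edge tt)
  backward-arc (forward _) not-forward _ = ⊥-elim (not-forward tt)
  backward-arc (backward along) _ _ = along

  edge-of : ∀ {x u v} (t : Traversal x u v) → T (isEdge t) → ∃[ e ] (x ≡ inj₁ e × Joins G (inj₁ e) u v)
  edge-of (edge is-edge joins) _ = _ , is-edge , joins

  module MinimalEdgeCover {FE : Subset m} {FA : Subset k}
                          (minimal : Minimal G (IsMixedEdgeCover G) (FE , FA)) where

    reached : ∀ v → ReachedFrom FE FA v
    reached = edge-cover⇒reached (proj₁ minimal)

    arc-essential : ∀ {a} → a ∈ FA → ¬ ReachedFrom FE (FA - a) (head a)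
    arc-essential {a} a∈ reached-head =
      p-x≢p a∈ (cong proj₂ (proj₂ minimal _ (id , p─q⊆p FA _) (reached⇒edge-cover reroute)))
      where
        reroute : ∀ v → ReachedFrom FE (FA - a) v
        reroute v with reached v
        ... | s , src , p = [ (λ q → s , src , q) , ReachedFrom-extend reached-head ]′ (Reach-after-last a p)

    edge-essential-ends : ∀ {e} → e ∈ FE →
                      ReachedFrom (FE - e) FA (end₁ e) → ReachedFrom (FE - e) FA (end₂ e) → ⊥
    edge-essential-ends {e} e∈ reached₁ reached₂ =
      p-x≢p e∈ (cong proj₁ (proj₂ minimal _ (p─q⊆p FE _ , id) (reached⇒edge-cover reroute)))
      where
        reroute : ∀ v → ReachedFrom (FE - e) FA v
        reroute v with reached v
        ... | s , (e' , e'∈ , end) , p with e' ≟ e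
        ...   | no e'≢e = s , (e' , x∈p∧x≢y⇒x∈p-y e'∈ e'≢e , end) , p
        ...   | yes refl = ReachedFrom-extend
          ([ (λ eq → subst (ReachedFrom _ _) eq reached₁)
           , (λ eq → subst (ReachedFrom _ _) eq reached₂) ]′ end) p

    edge-essential : ∀ {e u v} → e ∈ FE → Joins G (inj₁ e) u v →
                     ReachedFrom (FE - e) FA u → ReachedFrom (FE - e) FA v → ⊥
    edge-essential e∈ (inj₁ (refl , refl)) reached-u reached-v = edge-essential-ends e∈ reached-u reached-v
    edge-essential e∈ (inj₂ (refl , refl)) reached-u reached-v = edge-essential-ends e∈ reached-v reached-u

    arc-head-not-end : ∀ {a e} → a ∈ FA → e ∈ FE → ¬ EndOf e (head a)
    arc-head-not-end a∈ e∈ end = arc-essential a∈ (_ , (_ , e∈ , end) , here)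

    arc-head-injective : ∀ {a b} → a ∈ FA → b ∈ FA → head a ≡ head b → a ≡ b
    arc-head-injective {a} {b} a∈ b∈ same-head with a ≟ b
    ... | yes a≡b = a≡b
    ... | no a≢b with ReachedFrom-before-first (λ c → (c ≟ a) ⊎-dec (c ≟ b)) (reached (head a))
    ...   | inj₁ avoid = ⊥-elim (arc-essential a∈ (avoid (inj₁ refl)))
    ...   | inj₂ (_ , inj₁ refl , avoid) = ⊥-elim (arc-essential b∈ (subst (ReachedFrom _ _) same-head
            (ReachedFrom-extend (avoid (inj₂ refl)) (arc-Reach (x∈p∧x≢y⇒x∈p-y a∈ a≢b)))))
    ...   | inj₂ (_ , inj₂ refl , avoid) = ⊥-elim (arc-essential a∈ (subst (ReachedFrom _ _) (sym same-head)
            (ReachedFrom-extend (avoid (inj₁ refl)) (arc-Reach (x∈p∧x≢y⇒x∈p-y b∈ (a≢b ∘ sym))))))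

    -- The first arc of the family on a path from an edge is entered through the head of
    -- another family arc, which the path so far avoids.
    no-predecessor-closed-arcs : ∀ {r} (arcs : Fin r → Fin k) → (∀ i → arcs i ∈ FA) →
                                 (∀ i → ∃[ j ] head (arcs j) ≡ tail (arcs i)) → ¬ Fin r
    no-predecessor-closed-arcs arcs arcs∈ closed i₀
      with ReachedFrom-before-first (λ c → any? (λ i → arcs i ≟ c)) (reached (head (arcs i₀)))
    ... | inj₁ avoid = arc-essential (arcs∈ i₀) (avoid (i₀ , refl))
    ... | inj₂ (_ , (i , refl) , avoid) with closed i
    ...   | j , head-j = arc-essential (arcs∈ j) (subst (ReachedFrom _ _) (sym head-j) (avoid (j , refl)))

    module _ (C : Cycle G (FE , FA)) where
      open Cycle C

      trav : ∀ i → Traversal (elems i) (verts i) (verts (next G i))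
      trav i = traversal (joins i)

      elems-next≢ : ∀ i → elems (next G i) ≢ elems i
      elems-next≢ i = next-≢ i ∘ elems-inj

      arc∈FA : ∀ {i a} → elems i ≡ inj₂ a → a ∈ FA
      arc∈FA {i} eq = subst (λ x → _∈F_ G x (FE , FA)) eq (inF i)

      edge∈FE : ∀ {i e} → elems i ≡ inj₁ e → e ∈ FE
      edge∈FE {i} eq = subst (λ x → _∈F_ G x (FE , FA)) eq (inF i)

      along-arc∈ : ∀ {i u v} (α : Along (elems i) u v) → Along.arc α ∈ FA
      along-arc∈ α = arc∈FA (Along.is-arc α)

      forward-next : ∀ i → T (isForward (trav i)) → T (isForward (trav (next G i)))
      forward-next i with trav i | trav (next G i)
      ... | edge _ _ | _ = λ ()
      ... | backward _ | _ = λ ()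
      ... | forward _ | forward _ = λ _ → tt
      ... | forward α | edge is-edge joins = λ _ → ⊥-elim (arc-head-not-end (along-arc∈ α) (edge∈FE is-edge)
            (subst (EndOf _) (sym (Along.head≡ α)) (Joins-left joins)))
      ... | forward α | backward β = λ _ → ⊥-elim (elems-next≢ i
            (trans (Along.is-arc β) (trans (cong inj₂ same-arc) (sym (Along.is-arc α)))))
        where
          same-arc : Along.arc β ≡ Along.arc α
          same-arc = arc-head-injective (along-arc∈ β) (along-arc∈ α)
                       (trans (Along.head≡ β) (sym (Along.head≡ α)))

      edge-next : (∀ i → ¬ T (isForward (trav i))) →
                  ∀ i → T (isEdge (trav i)) → T (isEdge (trav (next G i)))
      edge-next no-forward i with trav i | trav (next G i) | no-forward (next G i)
      ... | forward _ | _ | _ = λ ()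
      ... | backward _ | _ | _ = λ ()
      ... | edge _ _ | edge _ _ | _ = λ _ → tt
      ... | edge _ _ | forward _ | not-forward = λ _ → ⊥-elim (not-forward tt)
      ... | edge is-edge joins | backward β | _ = λ _ → ⊥-elim (arc-head-not-end (along-arc∈ β) (edge∈FE is-edge)
            (subst (EndOf _) (sym (Along.head≡ β)) (Joins-right joins)))

      all-forward : (∀ i → T (isForward (trav i))) → ⊥
      all-forward is-forward =
        no-predecessor-closed-arcs (Along.arc ∘ along) (along-arc∈ ∘ along) closed zero
        where
          along : ∀ i → Along (elems i) (verts i) (verts (next G i))
          along i = forward-arc (trav i) (is-forward i)
          closed : ∀ i → ∃[ j ] head (Along.arc (along j)) ≡ tail (Along.arc (along i))
          closed i with next-surjective i
          ... | p , refl = p , trans (Along.head≡ (along p)) (sym (Along.tail≡ (along (next G p))))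

      all-backward : (∀ i → ¬ T (isForward (trav i))) → (∀ i → ¬ T (isEdge (trav i))) → ⊥
      all-backward not-forward not-edge =
        no-predecessor-closed-arcs (Along.arc ∘ along) (along-arc∈ ∘ along) closed zero
        where
          along : ∀ i → Along (elems i) (verts (next G i)) (verts i)
          along i = backward-arc (trav i) (not-forward i) (not-edge i)
          closed : ∀ i → ∃[ j ] head (Along.arc (along j)) ≡ tail (Along.arc (along i))
          closed i = next G i , trans (Along.head≡ (along (next G i))) (sym (Along.tail≡ (along i)))

      end-of-other-edge : ∀ {i j e e' w} → elems i ≡ inj₁ e → elems j ≡ inj₁ e' → j ≢ i →
                          EndOf e' w → ReachedFrom (FE - e) FA w
      end-of-other-edge {e = e} {e'} is-e is-e' j≢i end = _ , (e' , e'∈FE-e , end) , here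
        where
          e'∈FE-e : e' ∈ FE - e
          e'∈FE-e = x∈p∧x≢y⇒x∈p-y (edge∈FE is-e') λ { refl → j≢i (elems-inj (trans is-e' (sym is-e))) }

      -- The edge at position 1 shares its endpoints with the edges at positions 0 and 2.
      all-edges : (∀ i → T (isEdge (trav i))) → ⊥
      all-edges is-edge
        with edge-of (trav zero) (is-edge zero)
           | edge-of (trav (next G zero)) (is-edge (next G zero))
           | edge-of (trav (next G (next G zero))) (is-edge (next G (next G zero)))
      ... | _ , is₀ , joins₀ | _ , is₁ , joins₁ | _ , is₂ , joins₂ =
        edge-essential (edge∈FE is₁) joins₁
        (end-of-other-edge is₁ is₀ (next-≢ zero ∘ sym) (Joins-right joins₀))
        (end-of-other-edge is₁ is₂ (next-≢ (next G zero)) (Joins-left joins₂))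

      cycle-absurd : ⊥
      cycle-absurd with any? (λ i → T? (isForward (trav i)))
      ... | yes (_ , is-forward) = all-forward (next-induction _ forward-next is-forward)
      ... | no no-forward with any? (λ i → T? (isEdge (trav i)))
      ...   | yes (_ , is-edge) = all-edges (next-induction _ (edge-next λ i f → no-forward (i , f)) is-edge)
      ...   | no no-edge = all-backward (λ i f → no-forward (i , f)) (λ i e → no-edge (i , e))

    acyclic : ¬ Cycle G (FE , FA)
    acyclic = cycle-absurd

  minimal-edge-cover⇒minimal-forest : ∀ F → Minimal G (IsMixedEdgeCover G) F →
                                      Minimal G (IsMixedCoveringForest G) F
  minimal-edge-cover⇒minimal-forest (FE , FA) minimal@(cover , least) =
    (MinimalEdgeCover.acyclic minimal , edge-cover⇒covers cover) ,
    λ F' F'⊑F forest' → least F' F'⊑F (covering-forest⇒edge-cover F' forest')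

  minimal-forest⇒minimal-edge-cover : ∀ F → Minimal G (IsMixedCoveringForest G) F →
                                      Minimal G (IsMixedEdgeCover G) F
  minimal-forest⇒minimal-edge-cover (FE , FA) (forest@(acyclic , _) , least) =
    covering-forest⇒edge-cover _ forest ,
    λ { (FE' , FA') F'⊑F cover' → least _ F'⊑F (acyclic ∘ Cycle-mono F'⊑F , edge-cover⇒covers cover') }

proposition3 : ∀ {n : ℕ} (G : MixedGraph n) →
    (∀ (F : Sub G) → IsMixedCoveringForest G F → IsMixedEdgeCover G F) ×
    (∀ (F : Sub G) → Minimal G (IsMixedEdgeCover G) F ⇔ Minimal G (IsMixedCoveringForest G) F)
proposition3 G =
  covering-forest⇒edge-cover G ,
  λ F → mk⇔ (minimal-edge-cover⇒minimal-forest G F) (minimal-forest⇒minimal-edge-cover G F)
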